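{- Let $\alpha,k\in\mathbb{N}$ with $\alpha\geq 2$, and let $n\geq \alpha+2$ (with $n\geq 5$). If $n\geq \frac{2}{\alpha}k+4$, then there exists a $k$-tuple dominating set of $K(n,2)$ of cardinality $k+2\alpha$.
   Context: The Kneser graph $K(n,2)$ has as vertices the $2$-subsets of $[n]=\{1,\dots,n\}$, two vertices adjacent iff disjoint. For a vertex $v$, $N[v]$ is its closed neighbourhood. A set $D$ of vertices is a $k$-tuple dominating set if $|N[v]\cap D|\geq k$ for every vertex $v$. -}

module Defs where

open import Data.Nat using (ℕ; _≥_)
open import Data.Fin.Subset using (Subset; _∩_; ∣_∣; ⊥)
open import Data.Vec.Properties using (≡-dec)
import Data.Bool.Properties as BoolP
open import Data.List using (List; length; filter)
open import Data.List.Relation.Unary.All using (All)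
open import Data.List.Relation.Unary.Unique.Propositional using (Unique)
open import Data.Product using (_×_)
open import Data.Sum using (_⊎_)
open import Relation.Binary.PropositionalEquality using (_≡_)
open import Relation.Nullary.Decidable using (Dec; _⊎-dec_)

_≟_ : {n : ℕ} → (u w : Subset n) → Dec (u ≡ w)
_≟_ = ≡-dec BoolP._≟_

IsVertex : {n : ℕ} → Subset n → Set
IsVertex u = ∣ u ∣ ≡ 2

Adjacent : {n : ℕ} → Subset n → Subset n → Set
Adjacent u w = u ∩ w ≡ ⊥

InClosedNbhd : {n : ℕ} → Subset n → Subset n → Set
InClosedNbhd v u = (u ≡ v) ⊎ Adjacent u v

closedNbhdCount : {n : ℕ} → Subset n → List (Subset n) → ℕ
closedNbhdCount v D = length (filter (λ u → (u ≟ v) ⊎-dec ((u ∩ v) ≟ ⊥)) D)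

IsVertexSet : {n : ℕ} → List (Subset n) → Set
IsVertexSet D = All IsVertex D × Unique D

IsKTupleDominating : (n k : ℕ) → List (Subset n) → Set
IsKTupleDominating n k D = IsVertexSet D × ((v : Subset n) → IsVertex v → closedNbhdCount v D ≥ k)

{-# OPTIONS --safe #-}
module Submission where

-- If every point of [n] lies in at most α members of a set D of 2-subsets, then a vertex v
-- meets at most 2α members of D, and all other members of D are disjoint from v; hence
-- |N[v] ∩ D| ≥ |D| - 2α. So it suffices to find k + 2α edges of a simple graph on [n] of
-- maximum degree α. The circulant graph on ℤ_n with jumps 1, …, ⌊α/2⌋, together with the
-- matching {i, i + ⌊n/2⌋} when α is odd, has maximum degree α and ⌊αn/2⌋ ≥ k + 2α edges.

open import Defs
open import Data.Nat using (ℕ; zero; suc; _≤_; _<_; _≥_; _+_; _*_; _∸_; _⊓_; _≡ᵇ_; _<?_; z≤n; s≤s; s≤s⁻¹)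
open import Data.Nat.Properties hiding (_≟_)
open import Data.Nat.Tactic.RingSolver using (solve-∀)
open import Algebra.Properties.CommutativeSemigroup +-commutativeSemigroup using () renaming (interchange to +-interchange)
open import Data.Bool using (Bool; true; false; T; _∧_; _∨_; if_then_else_)
open import Data.Bool.Properties using (T-∨; T-≡; ∧-comm)
open import Data.Empty using (⊥-elim)
open import Data.Vec using (_∷_; []; lookup; tail)
open import Data.Vec.Properties using (lookup-replicate)
open import Data.Fin using (Fin; zero; suc; toℕ)
open import Data.Fin.Subset using (Subset; _∩_; ∣_∣; ⊥)
open import Data.Fin.Subset.Properties using (∣⊥∣≡0)
open import Data.List using (List; []; _∷_; length; map; take; _++_)
open import Data.List.Properties using (filter-accept; filter-reject; length-map; length-take; length-++)
open import Data.List.Relation.Unary.All as All using (All; []; _∷_)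
import Data.List.Relation.Unary.All.Properties as All
open import Data.List.Relation.Unary.AllPairs using ([]; _∷_)
open import Data.List.Relation.Unary.Unique.Propositional using (Unique)
import Data.List.Relation.Unary.Unique.Propositional.Properties as Unique
open import Data.List.Relation.Binary.Disjoint.Propositional using (Disjoint)
open import Data.Product using (Σ; _×_; _,_; proj₁; proj₂; uncurry)
open import Data.Sum using (_⊎_; inj₁; inj₂; [_,_]′)
open import Function using (_∘_; Equivalence)
open import Relation.Binary.PropositionalEquality using (_≡_; _≢_; refl; sym; trans; cong; cong₂; subst; module ≡-Reasoning)
open import Relation.Nullary using (yes; no; ¬_; contradiction)
open import Relation.Nullary.Decidable using (_⊎-dec_)

count : {A : Set} → (A → Bool) → List A → ℕ
count p [] = 0
count p (x ∷ xs) = if p x then suc (count p xs) else count p xs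

module _ {A : Set} where

  count-++ : (p : A → Bool) (xs ys : List A) → count p (xs ++ ys) ≡ count p xs + count p ys
  count-++ p [] ys = refl
  count-++ p (x ∷ xs) ys with p x
  ... | true = cong suc (count-++ p xs ys)
  ... | false = count-++ p xs ys

  count-map : {B : Set} (p : B → Bool) (f : A → B) (xs : List A) → count p (map f xs) ≡ count (p ∘ f) xs
  count-map p f [] = refl
  count-map p f (x ∷ xs) with p (f x)
  ... | true = cong suc (count-map p f xs)
  ... | false = count-map p f xs

  count-mono : {p q : A → Bool} → (∀ x → T (p x) → T (q x)) → (xs : List A) → count p xs ≤ count q xs
  count-mono p⇒q [] = z≤n
  count-mono {p} {q} p⇒q (x ∷ xs) with p x | q x | p⇒q x
  ... | true | true | _ = s≤s (count-mono p⇒q xs)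
  ... | true | false | px⇒qx = ⊥-elim (px⇒qx _)
  ... | false | true | _ = m≤n⇒m≤1+n (count-mono p⇒q xs)
  ... | false | false | _ = count-mono p⇒q xs

  count-∨ : (p q : A → Bool) (xs : List A) → count (λ x → p x ∨ q x) xs ≤ count p xs + count q xs
  count-∨ p q [] = z≤n
  count-∨ p q (x ∷ xs) with p x | q x
  ... | true | true = s≤s (≤-trans (count-∨ p q xs) (+-monoʳ-≤ (count p xs) (n≤1+n _)))
  ... | true | false = s≤s (count-∨ p q xs)
  ... | false | true = ≤-trans (s≤s (count-∨ p q xs)) (≤-reflexive (sym (+-suc _ _)))
  ... | false | false = count-∨ p q xs

  count-take : (p : A → Bool) (m : ℕ) (xs : List A) → count p (take m xs) ≤ count p xs
  count-take p zero xs = z≤n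
  count-take p (suc m) [] = z≤n
  count-take p (suc m) (x ∷ xs) with p x
  ... | true = s≤s (count-take p m xs)
  ... | false = count-take p m xs

  count-false : (xs : List A) → count (λ _ → false) xs ≡ 0
  count-false [] = refl
  count-false (x ∷ xs) = count-false xs

Unique-map⁺-on : {A B : Set} {P : A → Set} {f : A → B} {xs : List A} →
  (∀ {x y} → P x → P y → f x ≡ f y → x ≡ y) → All P xs → Unique xs → Unique (map f xs)
Unique-map⁺-on inj [] [] = []
Unique-map⁺-on {P = P} {f} {x ∷ _} inj (px ∷ pxs) (x≢xs ∷ unique) = distinct pxs x≢xs ∷ Unique-map⁺-on inj pxs unique
  where
  distinct : ∀ {ys} → All P ys → All (x ≢_) ys → All (f x ≢_) (map f ys)
  distinct [] [] = []
  distinct (py ∷ pys) (x≢y ∷ x≢ys) = (x≢y ∘ inj px py) ∷ distinct pys x≢ys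

disjoint-by : {A : Set} {P Q : A → Set} {xs ys : List A} →
  All P xs → All Q ys → (∀ {x} → P x → ¬ Q x) → Disjoint xs ys
disjoint-by Pxs Qys P⇒¬Q (x∈xs , x∈ys) = P⇒¬Q (All.lookup Pxs x∈xs) (All.lookup Qys x∈ys)

pointDegree : {n : ℕ} → Fin n → List (Subset n) → ℕ
pointDegree i = count (λ u → lookup u i)

pointDegree-tail : {n : ℕ} (i : Fin n) (D : List (Subset (suc n))) →
  pointDegree i (map tail D) ≤ pointDegree (suc i) D
pointDegree-tail i D = begin
  pointDegree i (map tail D)          ≡⟨ count-map (λ u → lookup u i) tail D ⟩
  count (λ u → lookup (tail u) i) D   ≤⟨ count-mono (λ { (_ ∷ _) t → t }) D ⟩
  pointDegree (suc i) D               ∎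
  where open ≤-Reasoning

meets : {n : ℕ} → Subset n → Subset n → Bool
meets u [] = false
meets u (y ∷ v) = (y ∧ lookup u zero) ∨ meets (tail u) v

meets≡false⇒disjoint : {n : ℕ} (u v : Subset n) → meets u v ≡ false → u ∩ v ≡ ⊥
meets≡false⇒disjoint [] [] _ = refl
meets≡false⇒disjoint (x ∷ u) (y ∷ v) uv with y ∧ x in yx | meets u v in u′v′
... | false | false = cong₂ _∷_ (trans (∧-comm x y) yx) (meets≡false⇒disjoint u v u′v′)

count-meets≤ : {n : ℕ} (α : ℕ) (v : Subset n) (D : List (Subset n)) →
  (∀ i → pointDegree i D ≤ α) → count (λ u → meets u v) D ≤ ∣ v ∣ * α
count-meets≤ α [] D _ = ≤-reflexive (count-false D)
count-meets≤ α (y ∷ v) D deg = splitOnHead y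
  where
  beyondHead : count (λ u → meets (tail u) v) D ≤ ∣ v ∣ * α
  beyondHead = begin
    count (λ u → meets (tail u) v) D     ≡⟨ count-map (λ u → meets u v) tail D ⟨
    count (λ u → meets u v) (map tail D) ≤⟨ count-meets≤ α v (map tail D) (λ i → ≤-trans (pointDegree-tail i D) (deg (suc i))) ⟩
    ∣ v ∣ * α                            ∎
    where open ≤-Reasoning

  splitOnHead : (y : Bool) → count (λ u → meets u (y ∷ v)) D ≤ ∣ y ∷ v ∣ * α
  splitOnHead false = beyondHead
  splitOnHead true = ≤-trans (count-∨ _ _ D) (+-mono-≤ (deg zero) beyondHead)

length≤closedNbhdCount+count-meets : {n : ℕ} (v : Subset n) (D : List (Subset n)) →
  length D ≤ closedNbhdCount v D + count (λ u → meets u v) D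
length≤closedNbhdCount+count-meets v [] = z≤n
length≤closedNbhdCount+count-meets v (u ∷ D) with (u ≟ v) ⊎-dec ((u ∩ v) ≟ ⊥)
... | yes inN rewrite filter-accept (λ w → (w ≟ v) ⊎-dec ((w ∩ v) ≟ ⊥)) {u} {D} inN with meets u v
...   | true = s≤s (≤-trans (length≤closedNbhdCount+count-meets v D) (+-monoʳ-≤ (closedNbhdCount v D) (n≤1+n _)))
...   | false = s≤s (length≤closedNbhdCount+count-meets v D)
length≤closedNbhdCount+count-meets v (u ∷ D) | no notInN
  rewrite filter-reject (λ w → (w ≟ v) ⊎-dec ((w ∩ v) ≟ ⊥)) {u} {D} notInN with meets u v in uv
...   | true = ≤-trans (s≤s (length≤closedNbhdCount+count-meets v D)) (≤-reflexive (sym (+-suc _ _)))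
...   | false = contradiction (inj₂ (meets≡false⇒disjoint u v uv)) notInN

isKTupleDominating-of-pointDegree≤ : {n α k : ℕ} (D : List (Subset n)) → IsVertexSet D →
  (∀ i → pointDegree i D ≤ α) → length D ≡ k + 2 * α → IsKTupleDominating n k D
isKTupleDominating-of-pointDegree≤ {α = α} {k} D isVertexSet deg ∣D∣ = isVertexSet , dominates
  where
  dominates : (v : Subset _) → IsVertex v → closedNbhdCount v D ≥ k
  dominates v ∣v∣≡2 = +-cancelʳ-≤ (2 * α) k _ (begin
    k + 2 * α                                    ≡⟨ ∣D∣ ⟨
    length D                                     ≤⟨ length≤closedNbhdCount+count-meets v D ⟩
    closedNbhdCount v D + count (λ u → meets u v) D ≤⟨ +-monoʳ-≤ _ (count-meets≤ α v D deg) ⟩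
    closedNbhdCount v D + ∣ v ∣ * α               ≡⟨ cong (λ c → closedNbhdCount v D + c * α) ∣v∣≡2 ⟩
    closedNbhdCount v D + 2 * α                  ∎)
    where open ≤-Reasoning

singleton : (n a : ℕ) → Subset n
singleton zero a = []
singleton (suc n) zero = true ∷ ⊥
singleton (suc n) (suc a) = false ∷ singleton n a

pair : (n a b : ℕ) → Subset n
pair zero a b = []
pair (suc n) zero zero = true ∷ ⊥
pair (suc n) zero (suc b) = true ∷ singleton n b
pair (suc n) (suc a) zero = true ∷ singleton n a
pair (suc n) (suc a) (suc b) = false ∷ pair n a b

∣singleton∣≡1 : ∀ {n a} → a < n → ∣ singleton n a ∣ ≡ 1
∣singleton∣≡1 {suc n} {zero} _ = cong suc (∣⊥∣≡0 n)
∣singleton∣≡1 {suc n} {suc a} (s≤s a<n) = ∣singleton∣≡1 a<n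

∣pair∣≡2 : ∀ {n a b} → a < b → b < n → ∣ pair n a b ∣ ≡ 2
∣pair∣≡2 {suc n} {zero} {suc b} _ (s≤s b<n) = cong suc (∣singleton∣≡1 b<n)
∣pair∣≡2 {suc n} {suc a} {suc b} (s≤s a<b) (s≤s b<n) = ∣pair∣≡2 a<b b<n

lookup-⊥ : ∀ {n} (i : Fin n) → ¬ T (lookup ⊥ i)
lookup-⊥ i = subst T (lookup-replicate i false)

lookup-singleton : ∀ {n} a (i : Fin n) → T (lookup (singleton n a) i) → toℕ i ≡ a
lookup-singleton zero zero _ = refl
lookup-singleton zero (suc i) i∈ = ⊥-elim (lookup-⊥ i i∈)
lookup-singleton (suc a) (suc i) i∈ = cong suc (lookup-singleton a i i∈)

lookup-pair : ∀ {n} a b (i : Fin n) → T (lookup (pair n a b) i) → toℕ i ≡ a ⊎ toℕ i ≡ b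
lookup-pair zero zero zero _ = inj₁ refl
lookup-pair zero zero (suc i) i∈ = ⊥-elim (lookup-⊥ i i∈)
lookup-pair zero (suc b) zero _ = inj₁ refl
lookup-pair zero (suc b) (suc i) i∈ = inj₂ (cong suc (lookup-singleton b i i∈))
lookup-pair (suc a) zero zero _ = inj₂ refl
lookup-pair (suc a) zero (suc i) i∈ = inj₁ (cong suc (lookup-singleton a i i∈))
lookup-pair (suc a) (suc b) (suc i) i∈ = Data.Sum.map (cong suc) (cong suc) (lookup-pair a b i i∈)

singleton-injective : ∀ {n a c} → a < n → singleton n a ≡ singleton n c → a ≡ c
singleton-injective {suc n} {zero} {zero} _ _ = refl
singleton-injective {suc n} {suc a} {suc c} (s≤s a<n) eq = cong suc (singleton-injective a<n (cong tail eq))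

pair-injective : ∀ {n a b c d} → a < b → b < n → c < d → d < n → pair n a b ≡ pair n c d → a ≡ c × b ≡ d
pair-injective {suc n} {zero} {suc b} {zero} {suc d} _ (s≤s b<n) _ _ eq =
  refl , cong suc (singleton-injective b<n (cong tail eq))
pair-injective {suc n} {suc a} {suc b} {suc c} {suc d} (s≤s a<b) (s≤s b<n) (s≤s c<d) (s≤s d<n) eq =
  Data.Product.map (cong suc) (cong suc) (pair-injective a<b b<n c<d d<n (cong tail eq))

Edge : Set
Edge = ℕ × ℕ

Graph : Set
Graph = List Edge

IsEdge : ℕ → Edge → Set
IsEdge n e = proj₁ e < proj₂ e × proj₂ e < n

IsGraph : ℕ → Graph → Set
IsGraph n G = All (IsEdge n) G × Unique G

startsAt endsAt : ℕ → Edge → Bool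
startsAt x e = proj₁ e ≡ᵇ x
endsAt x e = proj₂ e ≡ᵇ x

degree : ℕ → Graph → ℕ
degree x G = count (startsAt x) G + count (endsAt x) G

degree-++ : ∀ x G H → degree x (G ++ H) ≡ degree x G + degree x H
degree-++ x G H = begin
  count (startsAt x) (G ++ H) + count (endsAt x) (G ++ H)
    ≡⟨ cong₂ _+_ (count-++ (startsAt x) G H) (count-++ (endsAt x) G H) ⟩
  (count (startsAt x) G + count (startsAt x) H) + (count (endsAt x) G + count (endsAt x) H)
    ≡⟨ +-interchange (count (startsAt x) G) _ _ _ ⟩
  degree x G + degree x H ∎
  where open ≡-Reasoning

degree-take : ∀ x m G → degree x (take m G) ≤ degree x G
degree-take x m G = +-mono-≤ (count-take (startsAt x) m G) (count-take (endsAt x) m G)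

edgeSubset : (n : ℕ) → Edge → Subset n
edgeSubset n e = pair n (proj₁ e) (proj₂ e)

pointDegree-edgeSubsets≤degree : ∀ {n} (i : Fin n) G → pointDegree i (map (edgeSubset n) G) ≤ degree (toℕ i) G
pointDegree-edgeSubsets≤degree {n} i G = begin
  pointDegree i (map (edgeSubset n) G)                  ≡⟨ count-map (λ u → lookup u i) (edgeSubset n) G ⟩
  count (λ e → lookup (edgeSubset n e) i) G             ≤⟨ count-mono i∈e⇒endpoint G ⟩
  count (λ e → startsAt (toℕ i) e ∨ endsAt (toℕ i) e) G ≤⟨ count-∨ _ _ G ⟩
  degree (toℕ i) G                                      ∎
  where
  open ≤-Reasoning
  isEndpoint : ∀ a → toℕ i ≡ a → T (a ≡ᵇ toℕ i)
  isEndpoint a i≡a = ≡⇒≡ᵇ a (toℕ i) (sym i≡a)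
  i∈e⇒endpoint : ∀ e → T (lookup (edgeSubset n e) i) → T (startsAt (toℕ i) e ∨ endsAt (toℕ i) e)
  i∈e⇒endpoint (a , b) i∈e = Equivalence.from T-∨ (Data.Sum.map (isEndpoint a) (isEndpoint b) (lookup-pair a b i i∈e))

kTupleDominatingSet-of-graph : ∀ {n α k} (G : Graph) → IsGraph n G → (∀ x → degree x G ≤ α) →
  k + 2 * α ≤ length G → Σ (List (Subset n)) (λ D → IsKTupleDominating n k D × length D ≡ k + 2 * α)
kTupleDominatingSet-of-graph {n} {α} {k} G (isEdges , unique) maxDegree enough =
  D , isKTupleDominating-of-pointDegree≤ D (vertices , Unique-map⁺-on edgeSubset-injective isEdges′ unique′) pointDegree≤ ∣D∣ , ∣D∣
  where
  m = k + 2 * α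
  D = map (edgeSubset n) (take m G)
  isEdges′ = All.take⁺ m isEdges
  unique′ = Unique.take⁺ m unique
  ∣D∣ : length D ≡ m
  ∣D∣ = trans (length-map (edgeSubset n) (take m G)) (trans (length-take m G) (m≤n⇒m⊓n≡m enough))
  vertices : All IsVertex D
  vertices = All.map⁺ (All.map (λ (a<b , b<n) → ∣pair∣≡2 a<b b<n) isEdges′)
  edgeSubset-injective : ∀ {e f} → IsEdge n e → IsEdge n f → edgeSubset n e ≡ edgeSubset n f → e ≡ f
  edgeSubset-injective (a<b , b<n) (c<d , d<n) eq = uncurry (cong₂ _,_) (pair-injective a<b b<n c<d d<n eq)
  pointDegree≤ : ∀ i → pointDegree i D ≤ α
  pointDegree≤ i = ≤-trans (pointDegree-edgeSubsets≤degree i (take m G))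
                     (≤-trans (degree-take (toℕ i) m G) (maxDegree (toℕ i)))

jumps : ℕ → ℕ → Graph
jumps d zero = []
jumps d (suc m) = (m , m + d) ∷ jumps d m

length-jumps : ∀ d m → length (jumps d m) ≡ m
length-jumps d zero = refl
length-jumps d (suc m) = cong suc (length-jumps d m)

jumps-isEdge : ∀ {n d} m → 0 < d → m + d ≤ n → All (IsEdge n) (jumps d m)
jumps-isEdge zero _ _ = []
jumps-isEdge (suc m) 0<d m+d<n =
  (m<m+n m 0<d , m+d<n) ∷ jumps-isEdge m 0<d (<⇒≤ m+d<n)

jumps-startsBelow : ∀ d m → All (λ e → proj₁ e < m) (jumps d m)
jumps-startsBelow d zero = []
jumps-startsBelow d (suc m) = n<1+n m ∷ All.map m<n⇒m<1+n (jumps-startsBelow d m)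

jumps-unique : ∀ d m → Unique (jumps d m)
jumps-unique d zero = []
jumps-unique d (suc m) =
  All.map (λ start<m eq → <-irrefl (cong proj₁ (sym eq)) start<m) (jumps-startsBelow d m) ∷ jumps-unique d m

gap : Edge → ℕ
gap e = proj₂ e ∸ proj₁ e

jumps-gap : ∀ d m → All (λ e → gap e ≡ d) (jumps d m)
jumps-gap d zero = []
jumps-gap d (suc m) = m+n∸m≡n m d ∷ jumps-gap d m

≡ᵇ-true⇒≡ : ∀ {m n} → (m ≡ᵇ n) ≡ true → m ≡ n
≡ᵇ-true⇒≡ {m} {n} eq = ≡ᵇ⇒≡ m n (Equivalence.from T-≡ eq)

count-startsAt-jumps≡0 : ∀ {x} d m → m ≤ x → count (startsAt x) (jumps d m) ≡ 0
count-startsAt-jumps≡0 d zero _ = refl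
count-startsAt-jumps≡0 {x} d (suc m) m<x with m ≡ᵇ x in eq
... | true = contradiction (≡ᵇ-true⇒≡ eq) (<⇒≢ m<x)
... | false = count-startsAt-jumps≡0 d m (<⇒≤ m<x)

count-startsAt-jumps≤1 : ∀ x d m → count (startsAt x) (jumps d m) ≤ 1
count-startsAt-jumps≤1 x d zero = z≤n
count-startsAt-jumps≤1 x d (suc m) with m ≡ᵇ x in eq
... | true = s≤s (≤-reflexive (count-startsAt-jumps≡0 d m (≤-reflexive (≡ᵇ-true⇒≡ eq))))
... | false = count-startsAt-jumps≤1 x d m

count-endsAt-jumps≡0 : ∀ {x} d m → x < d ⊎ m + d ≤ x → count (endsAt x) (jumps d m) ≡ 0
count-endsAt-jumps≡0 d zero _ = refl
count-endsAt-jumps≡0 {x} d (suc m) outside with m + d ≡ᵇ x in eq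
... | true = contradiction (≡ᵇ-true⇒≡ eq) ([ (λ x<d → >⇒≢ (<-≤-trans x<d (m≤n+m d m))) , <⇒≢ ]′ outside)
... | false = count-endsAt-jumps≡0 d m (Data.Sum.map₂ <⇒≤ outside)

count-endsAt-jumps≤1 : ∀ x d m → count (endsAt x) (jumps d m) ≤ 1
count-endsAt-jumps≤1 x d zero = z≤n
count-endsAt-jumps≤1 x d (suc m) with m + d ≡ᵇ x in eq
... | true = s≤s (≤-reflexive (count-endsAt-jumps≡0 d m (inj₂ (≤-reflexive (≡ᵇ-true⇒≡ eq)))))
... | false = count-endsAt-jumps≤1 x d m

-- The edges of jumps d m start below m and those of jumps m e end at m or above.
count-startsAt-jumps+count-endsAt-jumps≤1 : ∀ x d m e →
  count (startsAt x) (jumps d m) + count (endsAt x) (jumps m e) ≤ 1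
count-startsAt-jumps+count-endsAt-jumps≤1 x d m e with x <? m
... | yes x<m rewrite count-endsAt-jumps≡0 {x} m e (inj₁ x<m) =
  ≤-trans (≤-reflexive (+-identityʳ _)) (count-startsAt-jumps≤1 x d m)
... | no x≮m rewrite count-startsAt-jumps≡0 d m (≮⇒≥ x≮m) = count-endsAt-jumps≤1 x m e

circularDistance : ℕ → Edge → ℕ
circularDistance n e = gap e ⊓ (n ∸ gap e)

jumps-circularDistance : ∀ n d m → All (λ e → circularDistance n e ≡ d ⊓ (n ∸ d)) (jumps d m)
jumps-circularDistance n d m = All.map (cong (λ g → g ⊓ (n ∸ g))) (jumps-gap d m)

-- The edges {i, i + c mod n} with i ≥ n ∸ c are the edges {i, i + (n ∸ c)} with i < c.
circulant : ℕ → ℕ → Graph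
circulant n c = jumps c (n ∸ c) ++ jumps (n ∸ c) c

length-circulant : ∀ {n c} → c ≤ n → length (circulant n c) ≡ n
length-circulant {n} {c} c≤n = begin
  length (jumps c (n ∸ c) ++ jumps (n ∸ c) c)               ≡⟨ length-++ (jumps c (n ∸ c)) ⟩
  length (jumps c (n ∸ c)) + length (jumps (n ∸ c) c)       ≡⟨ cong₂ _+_ (length-jumps c (n ∸ c)) (length-jumps (n ∸ c) c) ⟩
  n ∸ c + c                                                 ≡⟨ m∸n+n≡m c≤n ⟩
  n                                                         ∎
  where open ≡-Reasoning

circulant-isEdge : ∀ {n c} → 0 < c → c < n → All (IsEdge n) (circulant n c)
circulant-isEdge {n} {c} 0<c c<n = All.++⁺
  (jumps-isEdge (n ∸ c) 0<c (≤-reflexive (m∸n+n≡m (<⇒≤ c<n))))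
  (jumps-isEdge c (m<n⇒0<n∸m c<n) (≤-reflexive (trans (+-comm c (n ∸ c)) (m∸n+n≡m (<⇒≤ c<n)))))

c≢n∸c : ∀ {n c} → c + c < n → c ≢ n ∸ c
c≢n∸c {n} {c} c+c<n c≡n∸c = <-irrefl (trans (cong (_+ c) c≡n∸c) (m∸n+n≡m c≤n)) c+c<n
  where c≤n = ≤-trans (m≤n+m c c) (<⇒≤ c+c<n)

circulant-unique : ∀ {n c} → c + c < n → Unique (circulant n c)
circulant-unique {n} {c} c+c<n = Unique.++⁺ (jumps-unique c (n ∸ c)) (jumps-unique (n ∸ c) c)
  (disjoint-by (jumps-gap c (n ∸ c)) (jumps-gap (n ∸ c) c)
    (λ gap≡c gap≡n∸c → c≢n∸c c+c<n (trans (sym gap≡c) gap≡n∸c)))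

circulant-circularDistance : ∀ {n c} → c + c ≤ n → All (λ e → circularDistance n e ≡ c) (circulant n c)
circulant-circularDistance {n} {c} c+c≤n = All.++⁺
  (All.map (λ dist≡ → trans dist≡ (m≤n⇒m⊓n≡m c≤n∸c)) (jumps-circularDistance n c (n ∸ c)))
  (All.map (λ dist≡ → trans dist≡ (trans (cong ((n ∸ c) ⊓_) (m∸[m∸n]≡n c≤n)) (m≥n⇒m⊓n≡n c≤n∸c)))
    (jumps-circularDistance n (n ∸ c) c))
  where
  c≤n∸c = m+n≤o⇒m≤o∸n c c+c≤n
  c≤n = m+n≤o⇒n≤o c c+c≤n

degree-circulant≤2 : ∀ n c x → degree x (circulant n c) ≤ 2
degree-circulant≤2 n c x = begin
  degree x (jumps c m ++ jumps m c)   ≡⟨ degree-++ x (jumps c m) (jumps m c) ⟩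
  (sA + eA) + (sB + eB)               ≡⟨ rearrange sA eA sB eB ⟩
  (sA + eB) + (sB + eA)               ≤⟨ +-mono-≤ (count-startsAt-jumps+count-endsAt-jumps≤1 x c m c)
                                                  (count-startsAt-jumps+count-endsAt-jumps≤1 x m c m) ⟩
  2                                   ∎
  where
  open ≤-Reasoning
  m = n ∸ c
  sA = count (startsAt x) (jumps c m)
  eA = count (endsAt x) (jumps c m)
  sB = count (startsAt x) (jumps m c)
  eB = count (endsAt x) (jumps m c)
  rearrange : ∀ p q r s → (p + q) + (r + s) ≡ (p + s) + (r + q)
  rearrange = solve-∀

circulants : ℕ → ℕ → Graph
circulants n zero = []
circulants n (suc t) = circulants n t ++ circulant n (suc t)

m+m<n⇒m<n : ∀ {m n} → m + m < n → m < n
m+m<n⇒m<n {m} = ≤-<-trans (m≤m+n m m)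

[1+m]+[1+m]<n⇒m+m<n : ∀ {m n} → suc m + suc m < n → m + m < n
[1+m]+[1+m]<n⇒m+m<n {m} = <-trans (+-mono-< (n<1+n m) (n<1+n m))

circulants-isEdge : ∀ {n} t → t + t < n → All (IsEdge n) (circulants n t)
circulants-isEdge zero _ = []
circulants-isEdge (suc t) lt = All.++⁺ (circulants-isEdge t ([1+m]+[1+m]<n⇒m+m<n lt)) (circulant-isEdge (s≤s z≤n) (m+m<n⇒m<n lt))

circulants-circularDistance≤ : ∀ {n} t → t + t < n → All (λ e → circularDistance n e ≤ t) (circulants n t)
circulants-circularDistance≤ zero _ = []
circulants-circularDistance≤ (suc t) lt = All.++⁺
  (All.map m≤n⇒m≤1+n (circulants-circularDistance≤ t ([1+m]+[1+m]<n⇒m+m<n lt)))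
  (All.map ≤-reflexive (circulant-circularDistance (<⇒≤ lt)))

circulants-unique : ∀ {n} t → t + t < n → Unique (circulants n t)
circulants-unique zero _ = []
circulants-unique (suc t) lt = Unique.++⁺ (circulants-unique t ([1+m]+[1+m]<n⇒m+m<n lt)) (circulant-unique {c = suc t} lt)
  (disjoint-by (circulants-circularDistance≤ t ([1+m]+[1+m]<n⇒m+m<n lt)) (circulant-circularDistance (<⇒≤ lt))
    (λ dist≤t dist≡1+t → 1+n≰n (subst (_≤ t) dist≡1+t dist≤t)))

length-circulants : ∀ {n} t → t + t < n → length (circulants n t) ≡ t * n
length-circulants zero _ = refl
length-circulants {n} (suc t) lt = begin
  length (circulants n t ++ circulant n (suc t))         ≡⟨ length-++ (circulants n t) ⟩
  length (circulants n t) + length (circulant n (suc t)) ≡⟨ cong₂ _+_ (length-circulants t ([1+m]+[1+m]<n⇒m+m<n lt)) (length-circulant {c = suc t} (<⇒≤ (m+m<n⇒m<n lt))) ⟩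
  t * n + n                                              ≡⟨ +-comm (t * n) n ⟩
  suc t * n                                              ∎
  where open ≡-Reasoning

degree-circulants≤ : ∀ n t x → degree x (circulants n t) ≤ t + t
degree-circulants≤ n zero x = z≤n
degree-circulants≤ n (suc t) x = begin
  degree x (circulants n t ++ circulant n (suc t))         ≡⟨ degree-++ x (circulants n t) (circulant n (suc t)) ⟩
  degree x (circulants n t) + degree x (circulant n (suc t)) ≤⟨ +-mono-≤ (degree-circulants≤ n t x) (degree-circulant≤2 n (suc t) x) ⟩
  t + t + 2                                                ≡⟨ trans (+-comm (t + t) 2) (cong suc (sym (+-suc t t))) ⟩
  suc t + suc t                                            ∎
  where open ≤-Reasoning

-- α * n < 2 * (1 + length edges) says that there are at least ⌊α n / 2⌋ edges.
record DenseGraph (n α : ℕ) : Set where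
  field
    edges : Graph
    isGraph : IsGraph n edges
    maxDegree : ∀ x → degree x edges ≤ α
    dense : α * n < 2 * suc (length edges)

denseGraph-even : ∀ {n} t → t + t < n → DenseGraph n (t + t)
denseGraph-even {n} t t+t<n = record
  { edges = circulants n t
  ; isGraph = circulants-isEdge t t+t<n , circulants-unique t t+t<n
  ; maxDegree = λ x → degree-circulants≤ n t x
  ; dense = begin-strict
      (t + t) * n                        ≡⟨ double-* t n ⟩
      2 * (t * n)                        <⟨ *-monoʳ-< 2 (n<1+n (t * n)) ⟩
      2 * suc (t * n)                    ≡⟨ cong (λ l → 2 * suc l) (length-circulants t t+t<n) ⟨
      2 * suc (length (circulants n t))  ∎
  }
  where
  open ≤-Reasoning
  double-* : ∀ t n → (t + t) * n ≡ 2 * (t * n)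
  double-* = solve-∀

m+m<n+n⇒m<n : ∀ {m n} → m + m < n + n → m < n
m+m<n+n⇒m<n m+m<n+n = ≰⇒> (λ n≤m → <⇒≱ m+m<n+n (+-mono-≤ n≤m n≤m))

denseGraph-odd : ∀ {n} t h → h + h ≤ n → n ≤ suc (h + h) → suc (t + t) < n → DenseGraph n (suc (t + t))
denseGraph-odd {n} t h h+h≤n n≤1+h+h 1+t+t<n = record
  { edges = circulants n t ++ jumps h h
  ; isGraph = All.++⁺ (circulants-isEdge t t+t<n) (jumps-isEdge h (≤-<-trans z≤n t<h) h+h≤n)
            , Unique.++⁺ (circulants-unique t t+t<n) (jumps-unique h h)
                (disjoint-by (circulants-circularDistance≤ t t+t<n) (jumps-circularDistance n h h)
                  (λ dist≤t dist≡ → <⇒≱ t<h (subst (_≤ t) (trans dist≡ h⊓[n∸h]≡h) dist≤t)))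
  ; maxDegree = maxDegree
  ; dense = begin-strict
      n + (t + t) * n                        ≤⟨ +-monoˡ-≤ ((t + t) * n) n≤1+h+h ⟩
      suc (h + h) + (t + t) * n              ≡⟨ regroup h t n ⟩
      suc (2 * (t * n + h))                  <⟨ n<1+n _ ⟩
      2 + 2 * (t * n + h)                    ≡⟨ *-suc 2 (t * n + h) ⟨
      2 * suc (t * n + h)                    ≡⟨ cong (λ l → 2 * suc l) length≡ ⟨
      2 * suc (length (circulants n t ++ jumps h h)) ∎
  }
  where
  open ≤-Reasoning
  t<h : t < h
  t<h = m+m<n+n⇒m<n (s≤s⁻¹ (<-≤-trans 1+t+t<n n≤1+h+h))
  t+t<n : t + t < n
  t+t<n = <-trans (n<1+n (t + t)) 1+t+t<n
  h⊓[n∸h]≡h : h ⊓ (n ∸ h) ≡ h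
  h⊓[n∸h]≡h = m≤n⇒m⊓n≡m (m+n≤o⇒m≤o∸n h h+h≤n)
  maxDegree : ∀ x → degree x (circulants n t ++ jumps h h) ≤ suc (t + t)
  maxDegree x = begin
    degree x (circulants n t ++ jumps h h)             ≡⟨ degree-++ x (circulants n t) (jumps h h) ⟩
    degree x (circulants n t) + degree x (jumps h h)   ≤⟨ +-mono-≤ (degree-circulants≤ n t x)
                                                                (count-startsAt-jumps+count-endsAt-jumps≤1 x h h h) ⟩
    t + t + 1                                          ≡⟨ +-comm (t + t) 1 ⟩
    suc (t + t)                                        ∎
  length≡ : length (circulants n t ++ jumps h h) ≡ t * n + h
  length≡ = trans (length-++ (circulants n t)) (cong₂ _+_ (length-circulants t t+t<n) (length-jumps h h))
  regroup : ∀ h t n → suc (h + h) + (t + t) * n ≡ suc (2 * (t * n + h))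
  regroup = solve-∀

data Parity : ℕ → Set where
  even : ∀ t → Parity (t + t)
  odd : ∀ t → Parity (suc (t + t))

parity : ∀ n → Parity n
parity zero = even zero
parity (suc n) with parity n
... | even t = odd t
... | odd t = subst Parity (cong suc (+-suc t t)) (even (suc t))

denseGraph : ∀ {n} α → α < n → DenseGraph n α
denseGraph {n} α α<n with parity α | parity n
... | even t | _ = denseGraph-even t α<n
... | odd t | even h = denseGraph-odd t h ≤-refl (n≤1+n (h + h)) α<n
... | odd t | odd h = denseGraph-odd t h (n≤1+n (h + h)) ≤-refl α<n

lemma24 : (α k n : ℕ) → 2 ≤ α → α + 2 ≤ n → 5 ≤ n →
    2 * k + 4 * α ≤ α * n →
    Σ (List (Subset n)) (λ D → IsKTupleDominating n k D × length D ≡ k + 2 * α)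
lemma24 α k n _ α+2≤n _ 2k+4α≤αn = kTupleDominatingSet-of-graph edges isGraph maxDegree enough
  where
  open DenseGraph (denseGraph α (<-≤-trans (m<m+n α (s≤s z≤n)) α+2≤n))
  open ≤-Reasoning
  double : ∀ k α → 2 * (k + 2 * α) ≡ 2 * k + 4 * α
  double = solve-∀
  enough : k + 2 * α ≤ length edges
  enough = s≤s⁻¹ (*-cancelˡ-< 2 _ _ (begin-strict
    2 * (k + 2 * α)         ≡⟨ double k α ⟩
    2 * k + 4 * α           ≤⟨ 2k+4α≤αn ⟩
    α * n                   <⟨ dense ⟩
    2 * suc (length edges)  ∎))
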